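{- Let $m,d\geq 1$. (1) If $x^m-1$ divides $M_d(x)$, then $x^m-1$ divides $M_{de}(x)$ for all integers $e\geq 1$. (2) If $x^m+1$ divides $M_d(x)$, then $x^m+1$ divides $M_{de}(x)$ for all odd integers $e\geq 1$.
   Context: $M_d(x)=\frac1d\sum_{e\mid d}\mu(e)x^{d/e}\in\mathbb{Q}[x]$ is the $d$th necklace polynomial, $\mu$ the Möbius function. -}

module Defs where

open import Data.Bool using (Bool; true; false; if_then_else_; _∧_; not)
open import Data.Nat as ℕ using (ℕ; zero; suc; _∸_)
open import Data.Nat.Divisibility using (_∣_; _∣?_; divides)
open import Data.Nat.Primality using (prime?)
open import Data.Integer as ℤ using (ℤ; +_)
open import Data.Rational as ℚ using (ℚ; 0ℚ; 1ℚ; _/_)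
open import Data.List using (List; []; _∷_; [_]; _++_; replicate; filter; length; foldr; map)
open import Data.Product using (∃; _×_)
open import Relation.Binary.PropositionalEquality using (_≡_)
open import Relation.Nullary using (does; yes; no)

range1 : ℕ → List ℕ
range1 zero    = []
range1 (suc n) = range1 n ++ [ suc n ]

primeDivisors : ℕ → List ℕ
primeDivisors n = filter (λ p → prime? p) (filter (λ p → p ∣? n) (range1 n))

squarefree : ℕ → Bool
squarefree n = foldr (λ p b → not (does ((p ℕ.* p) ∣? n)) ∧ b) true (primeDivisors n)

μ : ℕ → ℤ
μ n = if squarefree n then (ℤ.- ℤ.1ℤ) ℤ.^ length (primeDivisors n) else ℤ.0ℤ

-- Polynomials over ℚ as coefficient lists (constant term first).

Poly : Set
Poly = List ℚ

coeff : Poly → ℕ → ℚ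
coeff []       _       = 0ℚ
coeff (a ∷ p)  zero    = a
coeff (a ∷ p)  (suc n) = coeff p n

_≈ᴾ_ : Poly → Poly → Set
p ≈ᴾ q = ∀ n → coeff p n ≡ coeff q n

infixl 6 _+ᴾ_
infixl 7 _*ᴾ_ _·ᴾ_

_+ᴾ_ : Poly → Poly → Poly
[]      +ᴾ q       = q
p       +ᴾ []      = p
(a ∷ p) +ᴾ (b ∷ q) = (a ℚ.+ b) ∷ (p +ᴾ q)

_·ᴾ_ : ℚ → Poly → Poly
c ·ᴾ p = map (c ℚ.*_) p

_*ᴾ_ : Poly → Poly → Poly
[]      *ᴾ q = []
(a ∷ p) *ᴾ q = (a ·ᴾ q) +ᴾ (0ℚ ∷ (p *ᴾ q))

X^ : ℕ → Poly
X^ n = replicate n 0ℚ ++ [ 1ℚ ]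

const : ℚ → Poly
const c = [ c ]

_∣ᴾ_ : Poly → Poly → Set
p ∣ᴾ q = ∃ λ r → q ≈ᴾ (p *ᴾ r)

-- Necklace polynomial M_d(x) = (1/d) Σ_{e ∣ d} μ(e) x^{d/e}   (d ≥ 1)

necklaceTerm : (d : ℕ) → ℚ → ℕ → Poly
necklaceTerm d c e with e ∣? d
... | yes (divides q _) = (c ℚ.* (μ e / 1)) ·ᴾ X^ q
... | no _              = []

-- M 0 is an irrelevant junk value; the statement only uses d ≥ 1
M : ℕ → Poly
M zero    = []
M (suc k) = foldr (λ e acc → necklaceTerm (suc k) (+ 1 / suc k) e +ᴾ acc) [] (range1 (suc k))

X^-1 : ℕ → Poly
X^-1 m = X^ m +ᴾ const (ℚ.- 1ℚ)

X^+1 : ℕ → Poly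
X^+1 m = X^ m +ᴾ const 1ℚ

module Submission where

open import Defs
open import Data.Nat using (ℕ; _*_; _≤_)
open import Data.Nat.Divisibility using (_∣_)
open import Data.Product using (_×_)
open import Relation.Nullary using (¬_)

-- Proof of Theorem 2.7.  Write the divisor as x^m + c, with c = -1 in part (1) and
-- c = 1 in part (2).  Call a prime p admissible if (-c)^p = -c; every prime is
-- admissible for c = -1, and exactly the odd primes are for c = 1.  Since e is a
-- product of primes, all admissible when e is odd in part (2), it suffices to pass
-- from M_n to M_{np} for a single admissible prime p.  For a prime p one has
--     M_{np}(x) = (1/p) (M_n(x^p) - ε M_n(x)),   ε = 0 if p ∣ n, ε = 1 otherwise,
-- which is checked coefficientwise from μ(tp) = -μ(t) for p ∤ t and μ(tp) = 0 for
-- p ∣ t.  If x^m + c divides M_n(x) = (x^m + c) r(x) then it divides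
-- M_n(x^p) = (x^{mp} + c) r(x^p), because x^{mp} + c = x^{mp} - (-c)^p is divisible
-- by x^m + c (geometric series); multiples of x^m + c being closed under linear
-- combinations, x^m + c divides M_{np}.

import Data.Integer.Properties as ℤP
import Data.List.Properties as LP
import Data.Nat.GCD as GCD
import Data.Nat.Properties as ℕP
import Data.Rational.Properties as ℚP
open import Data.Bool using (Bool; true; false; not; _∧_)
open import Data.Bool.Properties using (⇔→≡)
open import Data.Empty using (⊥-elim)
open import Data.Integer as ℤ using (+_)
open import Data.List using (List; []; _∷_; [_]; _++_; length; foldr; filter)
open import Data.List.Membership.Propositional using (_∈_)
open import Data.List.Membership.Propositional.Properties using (∈-filter⁺; ∈-filter⁻; ∈-++⁺ˡ; ∈-++⁺ʳ)
open import Data.List.Relation.Unary.All as All using (All)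
open import Data.List.Relation.Unary.Any using (here; there)
open import Data.Maybe using (Maybe; just; nothing)
open import Data.Nat as ℕ using (suc; zero; _+_; _∸_; _<_; _≤?_; z≤n; s≤s; NonZero)
open import Data.Nat.Coprimality using (Coprime; coprime-divisor)
open import Data.Nat.Divisibility using (_∣?_; divides; n∣m*n; m∣m*n; ∣m⇒∣m*n; ∣m∣n⇒∣m+n; ∣⇒≤; ∣-trans; ∣-refl; *-pres-∣; *-cancelʳ-∣)
open import Data.Nat.ListAction using (product)
open import Data.Nat.ListAction.Properties using (∈⇒∣product)
open import Data.Nat.Primality using (Prime; prime?; prime⇒nonTrivial; prime⇒nonZero; prime⇒irreducible; euclidsLemma)
open import Data.Nat.Primality.Factorisation using (factorise; PrimeFactorisation; factors)
open import Data.Nat.Tactic.RingSolver using (solve-∀)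
open import Data.Product using (Σ; _,_; proj₁)
open import Data.Rational as ℚ using (ℚ; 0ℚ; 1ℚ; _-_; _/_; ↥_; ↧_; ↧ₙ_)
open import Data.Sum using (inj₁; inj₂)
open import Function.Bundles using (_⇔_; mk⇔; Equivalence)
open import Level using (0ℓ)
open import Relation.Binary.PropositionalEquality hiding ([_])
open import Relation.Nullary using (Dec; yes; no; does)
open import Relation.Nullary.Decidable using (_×-dec_)
open import Tactic.RingSolver using (solve)
open import Tactic.RingSolver.Core.AlmostCommutativeRing using (AlmostCommutativeRing; fromCommutativeRing)

ℚring : AlmostCommutativeRing 0ℓ 0ℓ
ℚring = fromCommutativeRing ℚP.+-*-commutativeRing isZero
  where
  isZero : ∀ x → Maybe (0ℚ ≡ x)
  isZero x with 0ℚ ℚP.≟ x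
  ... | yes eq = just eq
  ... | no _   = nothing

-- shift m f: coefficients of x^m · f, for f given by its coefficient function
shift : ℕ → (ℕ → ℚ) → ℕ → ℚ
shift zero    f k       = f k
shift (suc m) f zero    = 0ℚ
shift (suc m) f (suc k) = shift m f k

shift-cong : ∀ m {f g} → (∀ j → f j ≡ g j) → ∀ k → shift m f k ≡ shift m g k
shift-cong zero    f≡g k       = f≡g k
shift-cong (suc m) f≡g zero    = refl
shift-cong (suc m) f≡g (suc k) = shift-cong m f≡g k

shift-+ : ∀ a b f k → shift a (shift b f) k ≡ shift (a + b) f k
shift-+ zero    b f k       = refl
shift-+ (suc a) b f zero    = refl
shift-+ (suc a) b f (suc k) = shift-+ a b f k

shift-map₂ : ∀ (F : ℚ → ℚ → ℚ) → F 0ℚ 0ℚ ≡ 0ℚ → ∀ m f g k →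
             shift m (λ j → F (f j) (g j)) k ≡ F (shift m f k) (shift m g k)
shift-map₂ F F00 zero    f g k       = refl
shift-map₂ F F00 (suc m) f g zero    = sym F00
shift-map₂ F F00 (suc m) f g (suc k) = shift-map₂ F F00 m f g k

shift-≥ : ∀ m f k → m ≤ k → shift m f k ≡ f (k ∸ m)
shift-≥ zero    f k       _         = refl
shift-≥ (suc m) f (suc k) (s≤s m≤k) = shift-≥ m f k m≤k

shift-< : ∀ m f k → k < m → shift m f k ≡ 0ℚ
shift-< (suc m) f zero    _         = refl
shift-< (suc m) f (suc k) (s≤s k<m) = shift-< m f k k<m

coeff-+ : ∀ p q n → coeff (p +ᴾ q) n ≡ coeff p n ℚ.+ coeff q n
coeff-+ []      q       n       = sym (ℚP.+-identityˡ _)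
coeff-+ (a ∷ p) []      n       = sym (ℚP.+-identityʳ _)
coeff-+ (a ∷ p) (b ∷ q) zero    = refl
coeff-+ (a ∷ p) (b ∷ q) (suc n) = coeff-+ p q n

coeff-· : ∀ c p n → coeff (c ·ᴾ p) n ≡ c ℚ.* coeff p n
coeff-· c []      n       = sym (ℚP.*-zeroʳ c)
coeff-· c (a ∷ p) zero    = refl
coeff-· c (a ∷ p) (suc n) = coeff-· c p n

coeff-∷* : ∀ a p r n → coeff ((a ∷ p) *ᴾ r) n ≡ a ℚ.* coeff r n ℚ.+ shift 1 (coeff (p *ᴾ r)) n
coeff-∷* a p r n = trans (coeff-+ (a ·ᴾ r) (0ℚ ∷ (p *ᴾ r)) n) (cong₂ ℚ._+_ (coeff-· a r n) (coeff-0∷ n))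
  where
  coeff-0∷ : ∀ n → coeff (0ℚ ∷ (p *ᴾ r)) n ≡ shift 1 (coeff (p *ᴾ r)) n
  coeff-0∷ zero    = refl
  coeff-0∷ (suc n) = refl

coeff-+* : ∀ p q r n → coeff ((p +ᴾ q) *ᴾ r) n ≡ coeff (p *ᴾ r) n ℚ.+ coeff (q *ᴾ r) n
coeff-+* []      q       r n = sym (ℚP.+-identityˡ _)
coeff-+* (a ∷ p) []      r n = sym (ℚP.+-identityʳ _)
coeff-+* (a ∷ p) (b ∷ q) r n = begin
    coeff (((a ℚ.+ b) ∷ (p +ᴾ q)) *ᴾ r) n
  ≡⟨ coeff-∷* (a ℚ.+ b) (p +ᴾ q) r n ⟩
    (a ℚ.+ b) ℚ.* R ℚ.+ shift 1 (coeff ((p +ᴾ q) *ᴾ r)) n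
  ≡⟨ cong ((a ℚ.+ b) ℚ.* R ℚ.+_) (shift-cong 1 (coeff-+* p q r) n) ⟩
    (a ℚ.+ b) ℚ.* R ℚ.+ shift 1 (λ j → coeff (p *ᴾ r) j ℚ.+ coeff (q *ᴾ r) j) n
  ≡⟨ cong ((a ℚ.+ b) ℚ.* R ℚ.+_) (shift-map₂ ℚ._+_ refl 1 (coeff (p *ᴾ r)) (coeff (q *ᴾ r)) n) ⟩
    (a ℚ.+ b) ℚ.* R ℚ.+ (P ℚ.+ Q)
  ≡⟨ regroup R P Q ⟩
    (a ℚ.* R ℚ.+ P) ℚ.+ (b ℚ.* R ℚ.+ Q)
  ≡⟨ sym (cong₂ ℚ._+_ (coeff-∷* a p r n) (coeff-∷* b q r n)) ⟩
    coeff ((a ∷ p) *ᴾ r) n ℚ.+ coeff ((b ∷ q) *ᴾ r) n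
  ∎
  where
  open ≡-Reasoning
  R : ℚ
  R = coeff r n
  P : ℚ
  P = shift 1 (coeff (p *ᴾ r)) n
  Q : ℚ
  Q = shift 1 (coeff (q *ᴾ r)) n
  regroup : ∀ R P Q → (a ℚ.+ b) ℚ.* R ℚ.+ (P ℚ.+ Q) ≡ (a ℚ.* R ℚ.+ P) ℚ.+ (b ℚ.* R ℚ.+ Q)
  regroup R P Q = solve (a ∷ b ∷ R ∷ P ∷ Q ∷ []) ℚring

shift-coeff[] : ∀ m k → shift m (coeff []) k ≡ 0ℚ
shift-coeff[] zero    k       = refl
shift-coeff[] (suc m) zero    = refl
shift-coeff[] (suc m) (suc k) = shift-coeff[] m k

coeff-X^* : ∀ m r k → coeff (X^ m *ᴾ r) k ≡ shift m (coeff r) k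
coeff-X^* zero r k =
  trans (coeff-∷* 1ℚ [] r k) (trans (cong₂ ℚ._+_ (ℚP.*-identityˡ (coeff r k)) (shift-coeff[] 1 k)) (ℚP.+-identityʳ (coeff r k)))
coeff-X^* (suc m) r k = begin
    coeff ((0ℚ ∷ X^ m) *ᴾ r) k                          ≡⟨ coeff-∷* 0ℚ (X^ m) r k ⟩
    0ℚ ℚ.* coeff r k ℚ.+ shift 1 (coeff (X^ m *ᴾ r)) k  ≡⟨ cong₂ ℚ._+_ (ℚP.*-zeroˡ (coeff r k)) (shift-cong 1 (coeff-X^* m r) k) ⟩
    0ℚ ℚ.+ shift 1 (shift m (coeff r)) k                ≡⟨ ℚP.+-identityˡ (shift 1 (shift m (coeff r)) k) ⟩
    shift 1 (shift m (coeff r)) k                       ≡⟨ shift-+ 1 m (coeff r) k ⟩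
    shift (suc m) (coeff r) k                           ∎
  where open ≡-Reasoning

coeff-const* : ∀ c r k → coeff (const c *ᴾ r) k ≡ c ℚ.* coeff r k
coeff-const* c r k = trans (coeff-∷* c [] r k) (trans (cong (c ℚ.* coeff r k ℚ.+_) (shift-coeff[] 1 k)) (ℚP.+-identityʳ (c ℚ.* coeff r k)))

coeff-binomial* : ∀ m c r k → coeff ((X^ m +ᴾ const c) *ᴾ r) k ≡ shift m (coeff r) k ℚ.+ c ℚ.* coeff r k
coeff-binomial* m c r k = trans (coeff-+* (X^ m) (const c) r k) (cong₂ ℚ._+_ (coeff-X^* m r k) (coeff-const* c r k))

MultipleOf : ℕ → ℚ → (ℕ → ℚ) → Set
MultipleOf m c f = Σ Poly λ r → ∀ k → f k ≡ shift m (coeff r) k ℚ.+ c ℚ.* coeff r k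

∣ᴾ⇒MultipleOf : ∀ m c P → (X^ m +ᴾ const c) ∣ᴾ P → MultipleOf m c (coeff P)
∣ᴾ⇒MultipleOf m c P (r , P≈) = r , λ k → trans (P≈ k) (coeff-binomial* m c r k)

MultipleOf⇒∣ᴾ : ∀ m c P → MultipleOf m c (coeff P) → (X^ m +ᴾ const c) ∣ᴾ P
MultipleOf⇒∣ᴾ m c P (r , P≡) = r , λ k → trans (P≡ k) (sym (coeff-binomial* m c r k))

MultipleOf-cong : ∀ {m c f g} → (∀ k → f k ≡ g k) → MultipleOf m c f → MultipleOf m c g
MultipleOf-cong f≡g (r , f≡) = r , λ k → trans (sym (f≡g k)) (f≡ k)

MultipleOf-linear : ∀ {m c f g} a b → MultipleOf m c f → MultipleOf m c g →
                    MultipleOf m c (λ k → a ℚ.* f k ℚ.+ b ℚ.* g k)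
MultipleOf-linear {m} {c} {f} {g} a b (r , f≡) (s , g≡) = a ·ᴾ r +ᴾ b ·ᴾ s , λ k → begin
    a ℚ.* f k ℚ.+ b ℚ.* g k
  ≡⟨ cong₂ (λ x y → a ℚ.* x ℚ.+ b ℚ.* y) (f≡ k) (g≡ k) ⟩
    a ℚ.* (shift m R k ℚ.+ c ℚ.* R k) ℚ.+ b ℚ.* (shift m S k ℚ.+ c ℚ.* S k)
  ≡⟨ regroup (shift m R k) (R k) (shift m S k) (S k) ⟩
    (a ℚ.* shift m R k ℚ.+ b ℚ.* shift m S k) ℚ.+ c ℚ.* (a ℚ.* R k ℚ.+ b ℚ.* S k)
  ≡⟨ sym (cong₂ (λ x y → x ℚ.+ c ℚ.* y) (shift-combination k) (coeff-combination k)) ⟩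
    shift m (coeff (a ·ᴾ r +ᴾ b ·ᴾ s)) k ℚ.+ c ℚ.* coeff (a ·ᴾ r +ᴾ b ·ᴾ s) k
  ∎
  where
  open ≡-Reasoning
  R : ℕ → ℚ
  R = coeff r
  S : ℕ → ℚ
  S = coeff s
  coeff-combination : ∀ k → coeff (a ·ᴾ r +ᴾ b ·ᴾ s) k ≡ a ℚ.* R k ℚ.+ b ℚ.* S k
  coeff-combination k = trans (coeff-+ (a ·ᴾ r) (b ·ᴾ s) k) (cong₂ ℚ._+_ (coeff-· a r k) (coeff-· b s k))
  combination-0 : a ℚ.* 0ℚ ℚ.+ b ℚ.* 0ℚ ≡ 0ℚ
  combination-0 = solve (a ∷ b ∷ []) ℚring
  shift-combination : ∀ k → shift m (coeff (a ·ᴾ r +ᴾ b ·ᴾ s)) k ≡ a ℚ.* shift m R k ℚ.+ b ℚ.* shift m S k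
  shift-combination k = trans (shift-cong m coeff-combination k)
                              (shift-map₂ (λ x y → a ℚ.* x ℚ.+ b ℚ.* y) combination-0 m R S k)
  regroup : ∀ x y z w → a ℚ.* (x ℚ.+ c ℚ.* y) ℚ.+ b ℚ.* (z ℚ.+ c ℚ.* w)
                        ≡ (a ℚ.* x ℚ.+ b ℚ.* z) ℚ.+ c ℚ.* (a ℚ.* y ℚ.+ b ℚ.* w)
  regroup x y z w = solve (a ∷ b ∷ c ∷ x ∷ y ∷ z ∷ w ∷ []) ℚring

-- substPow p f: the coefficients of f(x^p)
substPow : ℕ → (ℕ → ℚ) → ℕ → ℚ
substPow p f k with p ∣? k
... | yes (divides q _) = f q
... | no _              = 0ℚ

substPow-multiple : ∀ p f q → 1 ≤ p → substPow p f (q * p) ≡ f q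
substPow-multiple (suc p) f q _ with suc p ∣? q * suc p
... | yes (divides q′ qp≡q′p) = cong f (sym (ℕP.*-cancelʳ-≡ q q′ (suc p) qp≡q′p))
... | no ∤qp                  = ⊥-elim (∤qp (divides q refl))

substPow-nonmultiple : ∀ p f k → ¬ p ∣ k → substPow p f k ≡ 0ℚ
substPow-nonmultiple p f k ∤k with p ∣? k
... | yes p∣k = ⊥-elim (∤k p∣k)
... | no _    = refl

substPow-cong : ∀ p {f g} → (∀ j → f j ≡ g j) → ∀ k → substPow p f k ≡ substPow p g k
substPow-cong p f≡g k with p ∣? k
... | yes (divides q _) = f≡g q
... | no _              = refl

substPow-map₂ : ∀ (F : ℚ → ℚ → ℚ) → F 0ℚ 0ℚ ≡ 0ℚ → ∀ p f g k →
                substPow p (λ j → F (f j) (g j)) k ≡ F (substPow p f k) (substPow p g k)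
substPow-map₂ F F00 p f g k with p ∣? k
... | yes (divides q _) = refl
... | no _              = sym F00

substPow-shift : ∀ p m f k → 1 ≤ p → substPow p (shift m f) k ≡ shift (m * p) (substPow p f) k
substPow-shift (suc p) m f k _ with suc p ∣? k
substPow-shift (suc p) m f k _ | yes (divides q refl) with m ≤? q
... | yes m≤q = begin
    shift m f q                                   ≡⟨ shift-≥ m f q m≤q ⟩
    f (q ∸ m)                                     ≡⟨ sym (substPow-multiple (suc p) f (q ∸ m) (s≤s z≤n)) ⟩
    substPow (suc p) f ((q ∸ m) * suc p)          ≡⟨ cong (substPow (suc p) f) (ℕP.*-distribʳ-∸ (suc p) q m) ⟩
    substPow (suc p) f (q * suc p ∸ m * suc p)    ≡⟨ sym (shift-≥ (m * suc p) _ (q * suc p) (ℕP.*-monoˡ-≤ (suc p) m≤q)) ⟩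
    shift (m * suc p) (substPow (suc p) f) (q * suc p) ∎
  where open ≡-Reasoning
... | no m≰q = trans (shift-< m f q (ℕP.≰⇒> m≰q))
                     (sym (shift-< (m * suc p) _ (q * suc p) (ℕP.*-monoˡ-< (suc p) (ℕP.≰⇒> m≰q))))
substPow-shift (suc p) m f k _ | no ∤k with m * suc p ≤? k
... | yes mp≤k = sym (trans (shift-≥ (m * suc p) _ k mp≤k) (substPow-nonmultiple (suc p) f (k ∸ m * suc p) ∤k-mp))
  where
  ∤k-mp : ¬ suc p ∣ k ∸ m * suc p
  ∤k-mp ∣k-mp = ∤k (subst (suc p ∣_) (ℕP.m∸n+n≡m mp≤k) (∣m∣n⇒∣m+n ∣k-mp (n∣m*n m)))
... | no mp≰k = sym (shift-< (m * suc p) _ k (ℕP.≰⇒> mp≰k))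

VanishesFrom : ℕ → (ℕ → ℚ) → Set
VanishesFrom B f = ∀ k → B ≤ k → f k ≡ 0ℚ

coeff-vanishes : ∀ r → VanishesFrom (length r) (coeff r)
coeff-vanishes []      k       _         = refl
coeff-vanishes (a ∷ r) (suc k) (s≤s r≤k) = coeff-vanishes r k r≤k

substPow-vanishes : ∀ {B f} p → 1 ≤ p → VanishesFrom B f → VanishesFrom (B * p) (substPow p f)
substPow-vanishes {B} (suc p) _ f-vanishes k Bp≤k with suc p ∣? k
... | yes (divides q refl) = f-vanishes q (ℕP.*-cancelʳ-≤ B q (suc p) Bp≤k)
... | no _                 = refl

-- the polynomial with coefficient function f, if f vanishes from N on
toPoly : ℕ → (ℕ → ℚ) → Poly
toPoly zero    f = []
toPoly (suc N) f = f 0 ∷ toPoly N (λ k → f (suc k))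

coeff-toPoly : ∀ N f → VanishesFrom N f → ∀ k → coeff (toPoly N f) k ≡ f k
coeff-toPoly zero    f f-vanishes k       = sym (f-vanishes k z≤n)
coeff-toPoly (suc N) f f-vanishes zero    = refl
coeff-toPoly (suc N) f f-vanishes (suc k) =
  coeff-toPoly N (λ k → f (suc k)) (λ k N≤k → f-vanishes (suc k) (s≤s N≤k)) k

substPowᴾ : ℕ → Poly → Poly
substPowᴾ p r = toPoly (length r * p) (substPow p (coeff r))

coeff-substPowᴾ : ∀ p r → 1 ≤ p → ∀ k → coeff (substPowᴾ p r) k ≡ substPow p (coeff r) k
coeff-substPowᴾ p r 1≤p = coeff-toPoly (length r * p) _ (substPow-vanishes p 1≤p (coeff-vanishes r))

pow : ℚ → ℕ → ℚ
pow x zero    = 1ℚ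
pow x (suc n) = x ℚ.* pow x n

-- geometricQuot m c s n = Σ_{i<n} (-c)^{n-1-i} x^{im} · s, the quotient of
-- (x^{nm} - (-c)^n) · s by x^m + c
geometricQuot : ℕ → ℚ → Poly → ℕ → Poly
geometricQuot m c s zero    = []
geometricQuot m c s (suc n) = X^ (n * m) *ᴾ s +ᴾ (ℚ.- c) ·ᴾ geometricQuot m c s n

coeff-geometricQuot-suc : ∀ m c s n j →
  coeff (geometricQuot m c s (suc n)) j ≡ shift (n * m) (coeff s) j ℚ.+ (ℚ.- c) ℚ.* coeff (geometricQuot m c s n) j
coeff-geometricQuot-suc m c s n j =
  trans (coeff-+ (X^ (n * m) *ᴾ s) _ j) (cong₂ ℚ._+_ (coeff-X^* (n * m) s j) (coeff-· (ℚ.- c) (geometricQuot m c s n) j))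

shift-geometricQuot-suc : ∀ m c s n k →
  shift m (coeff (geometricQuot m c s (suc n))) k
  ≡ shift (suc n * m) (coeff s) k ℚ.+ (ℚ.- c) ℚ.* shift m (coeff (geometricQuot m c s n)) k
shift-geometricQuot-suc m c s n k = begin
    shift m (coeff (geometricQuot m c s (suc n))) k
  ≡⟨ shift-cong m (coeff-geometricQuot-suc m c s n) k ⟩
    shift m (λ j → shift (n * m) S j ℚ.+ (ℚ.- c) ℚ.* G j) k
  ≡⟨ shift-map₂ (λ x y → x ℚ.+ (ℚ.- c) ℚ.* y) (solve (c ∷ []) ℚring) m (shift (n * m) S) G k ⟩
    shift m (shift (n * m) S) k ℚ.+ (ℚ.- c) ℚ.* shift m G k
  ≡⟨ cong (ℚ._+ (ℚ.- c) ℚ.* shift m G k) (shift-+ m (n * m) S k) ⟩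
    shift (suc n * m) S k ℚ.+ (ℚ.- c) ℚ.* shift m G k
  ∎
  where
  open ≡-Reasoning
  S : ℕ → ℚ
  S = coeff s
  G : ℕ → ℚ
  G = coeff (geometricQuot m c s n)

geometric : ∀ m c s n k →
            shift m (coeff (geometricQuot m c s n)) k ℚ.+ c ℚ.* coeff (geometricQuot m c s n) k
            ≡ shift (n * m) (coeff s) k - pow (ℚ.- c) n ℚ.* coeff s k
geometric m c s zero k = begin
    shift m (coeff []) k ℚ.+ c ℚ.* 0ℚ   ≡⟨ cong (ℚ._+ c ℚ.* 0ℚ) (shift-coeff[] m k) ⟩
    0ℚ ℚ.+ c ℚ.* 0ℚ                     ≡⟨ base (coeff s k) ⟩
    coeff s k - 1ℚ ℚ.* coeff s k        ∎
  where
  open ≡-Reasoning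
  base : ∀ x → 0ℚ ℚ.+ c ℚ.* 0ℚ ≡ x - 1ℚ ℚ.* x
  base x = solve (c ∷ x ∷ []) ℚring
geometric m c s (suc n) k = begin
    shift m G′ k ℚ.+ c ℚ.* G′ k
  ≡⟨ cong₂ (λ x y → x ℚ.+ c ℚ.* y) (shift-geometricQuot-suc m c s n k) (coeff-geometricQuot-suc m c s n k) ⟩
    (shift (suc n * m) S k ℚ.+ (ℚ.- c) ℚ.* shift m G k) ℚ.+ c ℚ.* (shift (n * m) S k ℚ.+ (ℚ.- c) ℚ.* G k)
  ≡⟨ regroup (shift (suc n * m) S k) (shift m G k) (shift (n * m) S k) (G k) ⟩
    shift (suc n * m) S k ℚ.+ (ℚ.- c) ℚ.* (shift m G k ℚ.+ c ℚ.* G k) ℚ.+ c ℚ.* shift (n * m) S k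
  ≡⟨ cong (λ z → shift (suc n * m) S k ℚ.+ (ℚ.- c) ℚ.* z ℚ.+ c ℚ.* shift (n * m) S k) (geometric m c s n k) ⟩
    shift (suc n * m) S k ℚ.+ (ℚ.- c) ℚ.* (shift (n * m) S k - pow (ℚ.- c) n ℚ.* S k) ℚ.+ c ℚ.* shift (n * m) S k
  ≡⟨ cancel (shift (suc n * m) S k) (shift (n * m) S k) (pow (ℚ.- c) n) (S k) ⟩
    shift (suc n * m) S k - pow (ℚ.- c) (suc n) ℚ.* S k
  ∎
  where
  open ≡-Reasoning
  S : ℕ → ℚ
  S = coeff s
  G : ℕ → ℚ
  G = coeff (geometricQuot m c s n)
  G′ : ℕ → ℚ
  G′ = coeff (geometricQuot m c s (suc n))
  regroup : ∀ a b d g → (a ℚ.+ (ℚ.- c) ℚ.* b) ℚ.+ c ℚ.* (d ℚ.+ (ℚ.- c) ℚ.* g)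
                        ≡ a ℚ.+ (ℚ.- c) ℚ.* (b ℚ.+ c ℚ.* g) ℚ.+ c ℚ.* d
  regroup a b d g = solve (a ∷ b ∷ c ∷ d ∷ g ∷ []) ℚring
  cancel : ∀ a d w x → a ℚ.+ (ℚ.- c) ℚ.* (d - w ℚ.* x) ℚ.+ c ℚ.* d ≡ a - ((ℚ.- c) ℚ.* w) ℚ.* x
  cancel a d w x = solve (a ∷ c ∷ d ∷ w ∷ x ∷ []) ℚring

-- If x^m + c divides f and (-c)^p = -c, then x^m + c divides f(x^p): indeed
-- f(x^p) = (x^{mp} + c) · r(x^p) and x^{mp} + c = x^{mp} - (-c)^p.
MultipleOf-substPow : ∀ {m c f} p → 1 ≤ p → pow (ℚ.- c) p ≡ ℚ.- c →
                      MultipleOf m c f → MultipleOf m c (substPow p f)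
MultipleOf-substPow {m} {c} {f} p 1≤p pow≡ (r , f≡) = geometricQuot m c (substPowᴾ p r) p , λ k → begin
    substPow p f k
  ≡⟨ substPow-cong p f≡ k ⟩
    substPow p (λ j → shift m R j ℚ.+ c ℚ.* R j) k
  ≡⟨ substPow-map₂ (λ x y → x ℚ.+ c ℚ.* y) (solve (c ∷ []) ℚring) p (shift m R) R k ⟩
    substPow p (shift m R) k ℚ.+ c ℚ.* substPow p R k
  ≡⟨ cong (ℚ._+ c ℚ.* substPow p R k) (substPow-shift p m R k 1≤p) ⟩
    shift (m * p) (substPow p R) k ℚ.+ c ℚ.* substPow p R k
  ≡⟨ cong₂ (λ n x → shift n (substPow p R) k ℚ.+ c ℚ.* x) (ℕP.*-comm m p) (sym (coeff-substPowᴾ p r 1≤p k)) ⟩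
    shift (p * m) (substPow p R) k ℚ.+ c ℚ.* S k
  ≡⟨ cong (ℚ._+ c ℚ.* S k) (shift-cong (p * m) (λ j → sym (coeff-substPowᴾ p r 1≤p j)) k) ⟩
    shift (p * m) S k ℚ.+ c ℚ.* S k
  ≡⟨ as-difference (shift (p * m) S k) (S k) ⟩
    shift (p * m) S k - (ℚ.- c) ℚ.* S k
  ≡⟨ cong (λ w → shift (p * m) S k - w ℚ.* S k) (sym pow≡) ⟩
    shift (p * m) S k - pow (ℚ.- c) p ℚ.* S k
  ≡⟨ sym (geometric m c (substPowᴾ p r) p k) ⟩
    shift m (coeff (geometricQuot m c (substPowᴾ p r) p)) k ℚ.+ c ℚ.* coeff (geometricQuot m c (substPowᴾ p r) p) k
  ∎
  where
  open ≡-Reasoning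
  R : ℕ → ℚ
  R = coeff r
  S : ℕ → ℚ
  S = coeff (substPowᴾ p r)
  as-difference : ∀ x y → x ℚ.+ c ℚ.* y ≡ x - (ℚ.- c) ℚ.* y
  as-difference x y = solve (x ∷ y ∷ c ∷ []) ℚring

sumℚ : (ℕ → ℚ) → List ℕ → ℚ
sumℚ F = foldr (λ e acc → F e ℚ.+ acc) 0ℚ

coeff-sumᴾ : ∀ (T : ℕ → Poly) xs j →
             coeff (foldr (λ e acc → T e +ᴾ acc) [] xs) j ≡ sumℚ (λ e → coeff (T e) j) xs
coeff-sumᴾ T []       j = refl
coeff-sumᴾ T (x ∷ xs) j = trans (coeff-+ (T x) _ j) (cong (coeff (T x) j ℚ.+_) (coeff-sumᴾ T xs j))

sumℚ-++ : ∀ F xs ys → sumℚ F (xs ++ ys) ≡ sumℚ F xs ℚ.+ sumℚ F ys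
sumℚ-++ F []       ys = sym (ℚP.+-identityˡ _)
sumℚ-++ F (x ∷ xs) ys = trans (cong (F x ℚ.+_) (sumℚ-++ F xs ys)) (sym (ℚP.+-assoc (F x) _ _))

sumℚ-range1-suc : ∀ F N → sumℚ F (range1 (suc N)) ≡ sumℚ F (range1 N) ℚ.+ F (suc N)
sumℚ-range1-suc F N = trans (sumℚ-++ F (range1 N) [ suc N ]) (cong (sumℚ F (range1 N) ℚ.+_) (ℚP.+-identityʳ (F (suc N))))

sumℚ-range1-zero : ∀ F N → (∀ e → e ≤ N → F e ≡ 0ℚ) → sumℚ F (range1 N) ≡ 0ℚ
sumℚ-range1-zero F zero    F≡0 = refl
sumℚ-range1-zero F (suc N) F≡0 = begin
    sumℚ F (range1 (suc N))           ≡⟨ sumℚ-range1-suc F N ⟩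
    sumℚ F (range1 N) ℚ.+ F (suc N)   ≡⟨ cong₂ ℚ._+_ (sumℚ-range1-zero F N (λ e e≤N → F≡0 e (ℕP.m≤n⇒m≤1+n e≤N)))
                                                     (F≡0 (suc N) ℕP.≤-refl) ⟩
    0ℚ ℚ.+ 0ℚ                         ≡⟨ ℚP.+-identityʳ 0ℚ ⟩
    0ℚ                                ∎
  where open ≡-Reasoning

sumℚ-range1-single : ∀ F N q → 1 ≤ q → q ≤ N → (∀ e → e ≢ q → F e ≡ 0ℚ) → sumℚ F (range1 N) ≡ F q
sumℚ-range1-single F zero    (suc q) _ () _
sumℚ-range1-single F (suc N) q 1≤q q≤N F≡0 with suc N ℕ.≟ q
... | yes refl = begin
    sumℚ F (range1 (suc N))          ≡⟨ sumℚ-range1-suc F N ⟩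
    sumℚ F (range1 N) ℚ.+ F (suc N)  ≡⟨ cong (ℚ._+ F (suc N)) (sumℚ-range1-zero F N below-q) ⟩
    0ℚ ℚ.+ F (suc N)                 ≡⟨ ℚP.+-identityˡ (F (suc N)) ⟩
    F (suc N)                        ∎
  where
  open ≡-Reasoning
  below-q : ∀ e → e ≤ N → F e ≡ 0ℚ
  below-q e e≤N = F≡0 e (λ e≡q → ℕP.<-irrefl e≡q (s≤s e≤N))
... | no N+1≢q = begin
    sumℚ F (range1 (suc N))          ≡⟨ sumℚ-range1-suc F N ⟩
    sumℚ F (range1 N) ℚ.+ F (suc N)  ≡⟨ cong₂ ℚ._+_ (sumℚ-range1-single F N q 1≤q q≤N′ F≡0) (F≡0 (suc N) N+1≢q) ⟩
    F q ℚ.+ 0ℚ                       ≡⟨ ℚP.+-identityʳ (F q) ⟩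
    F q                              ∎
  where
  open ≡-Reasoning
  q≤N′ : q ≤ N
  q≤N′ = ℕP.≤-pred (ℕP.≤∧≢⇒< q≤N (λ q≡N+1 → N+1≢q (sym q≡N+1)))

coeff-necklaceTerm-hit : ∀ n c e j → n ≡ j * suc e → coeff (necklaceTerm n c (suc e)) j ≡ c ℚ.* (μ (suc e) / 1)
coeff-necklaceTerm-hit n c e j n≡je with suc e ∣? n
... | no ∤n = ⊥-elim (∤n (divides j n≡je))
... | yes (divides q n≡qe) = begin
    coeff (a ·ᴾ X^ q) j   ≡⟨ coeff-· a (X^ q) j ⟩
    a ℚ.* coeff (X^ q) j  ≡⟨ cong (λ i → a ℚ.* coeff (X^ q) i) (ℕP.*-cancelʳ-≡ j q (suc e) (trans (sym n≡je) n≡qe)) ⟩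
    a ℚ.* coeff (X^ q) q  ≡⟨ cong (a ℚ.*_) (coeff-X^-same q) ⟩
    a ℚ.* 1ℚ              ≡⟨ ℚP.*-identityʳ a ⟩
    a                     ∎
  where
  open ≡-Reasoning
  a : ℚ
  a = c ℚ.* (μ (suc e) / 1)
  coeff-X^-same : ∀ q → coeff (X^ q) q ≡ 1ℚ
  coeff-X^-same zero    = refl
  coeff-X^-same (suc q) = coeff-X^-same q

coeff-necklaceTerm-miss : ∀ n c e j → n ≢ e * j → coeff (necklaceTerm n c e) j ≡ 0ℚ
coeff-necklaceTerm-miss n c e j n≢je with e ∣? n
... | no _ = refl
... | yes (divides q n≡qe) = begin
    coeff (a ·ᴾ X^ q) j   ≡⟨ coeff-· a (X^ q) j ⟩
    a ℚ.* coeff (X^ q) j  ≡⟨ cong (a ℚ.*_) (coeff-X^-other q j q≢j) ⟩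
    a ℚ.* 0ℚ              ≡⟨ ℚP.*-zeroʳ a ⟩
    0ℚ                    ∎
  where
  open ≡-Reasoning
  a : ℚ
  a = c ℚ.* (μ e / 1)
  q≢j : q ≢ j
  q≢j q≡j = n≢je (trans n≡qe (trans (cong (_* e) q≡j) (ℕP.*-comm j e)))
  coeff-X^-other : ∀ q j → q ≢ j → coeff (X^ q) j ≡ 0ℚ
  coeff-X^-other zero    zero    q≢j = ⊥-elim (q≢j refl)
  coeff-X^-other zero    (suc j) q≢j = refl
  coeff-X^-other (suc q) zero    q≢j = refl
  coeff-X^-other (suc q) (suc j) q≢j = coeff-X^-other q j (λ q≡j → q≢j (cong suc q≡j))

coeff-M-divisor : ∀ n k q → suc n ≡ k * q → coeff (M (suc n)) k ≡ (+ 1 / suc n) ℚ.* (μ q / 1)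
coeff-M-divisor n zero    q       ()
coeff-M-divisor n (suc k) zero    n+1≡k0 = ⊥-elim (ℕP.1+n≢0 (trans n+1≡k0 (ℕP.*-zeroʳ (suc k))))
coeff-M-divisor n (suc k) (suc q) n+1≡kq = begin
    coeff (M (suc n)) (suc k)
  ≡⟨ coeff-sumᴾ (necklaceTerm (suc n) (+ 1 / suc n)) (range1 (suc n)) (suc k) ⟩
    sumℚ F (range1 (suc n))
  ≡⟨ sumℚ-range1-single F (suc n) (suc q) (s≤s z≤n) (∣⇒≤ (divides (suc k) n+1≡kq)) other-terms ⟩
    F (suc q)
  ≡⟨ coeff-necklaceTerm-hit (suc n) (+ 1 / suc n) q (suc k) n+1≡kq ⟩
    (+ 1 / suc n) ℚ.* (μ (suc q) / 1)
  ∎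
  where
  open ≡-Reasoning
  F : ℕ → ℚ
  F e = coeff (necklaceTerm (suc n) (+ 1 / suc n) e) (suc k)
  other-terms : ∀ e → e ≢ suc q → F e ≡ 0ℚ
  other-terms e e≢q = coeff-necklaceTerm-miss (suc n) (+ 1 / suc n) e (suc k) λ n+1≡ke →
    e≢q (ℕP.*-cancelʳ-≡ e (suc q) (suc k) (trans (sym n+1≡ke) (trans n+1≡kq (ℕP.*-comm (suc k) (suc q)))))

coeff-M-nondivisor : ∀ n k → ¬ k ∣ suc n → coeff (M (suc n)) k ≡ 0ℚ
coeff-M-nondivisor n k k∤n = trans (coeff-sumᴾ (necklaceTerm (suc n) (+ 1 / suc n)) (range1 (suc n)) k)
  (sumℚ-range1-zero _ (suc n) λ e _ → coeff-necklaceTerm-miss (suc n) (+ 1 / suc n) e k λ n+1≡ke →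
     k∤n (divides e n+1≡ke))

prime>1 : ∀ {p} → Prime p → 1 < p
prime>1 {p} p-prime = ℕ.nonTrivial⇒n>1 p {{prime⇒nonTrivial p-prime}}

prime≢1 : ∀ {p} → Prime p → p ≢ 1
prime≢1 p-prime refl = ℕP.<-irrefl refl (prime>1 p-prime)

prime∣prime : ∀ {q p} → Prime q → Prime p → q ∣ p → q ≡ p
prime∣prime q-prime p-prime q∣p with prime⇒irreducible p-prime q∣p
... | inj₁ q≡1 = ⊥-elim (prime≢1 q-prime q≡1)
... | inj₂ q≡p = q≡p

prime∤⇒coprime : ∀ {a p} → Prime p → ¬ p ∣ a → Coprime a p
prime∤⇒coprime p-prime p∤a (d∣a , d∣p) with prime⇒irreducible p-prime d∣p
... | inj₁ d≡1 = d≡1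
... | inj₂ refl = ⊥-elim (p∤a d∣a)

PrimeDivisor : ℕ → ℕ → Set
PrimeDivisor n q = q ∣ n × Prime q

#primeDivisors : ℕ → List ℕ → ℕ
#primeDivisors n xs = length (filter (λ p → prime? p) (filter (λ p → p ∣? n) xs))

#primeDivisors-++ : ∀ n xs ys → #primeDivisors n (xs ++ ys) ≡ #primeDivisors n xs + #primeDivisors n ys
#primeDivisors-++ n xs ys = begin
    length (filter (λ p → prime? p) (filter (λ p → p ∣? n) (xs ++ ys)))
  ≡⟨ cong (λ zs → length (filter (λ p → prime? p) zs)) (LP.filter-++ (λ p → p ∣? n) xs ys) ⟩
    length (filter (λ p → prime? p) (filter (λ p → p ∣? n) xs ++ filter (λ p → p ∣? n) ys))
  ≡⟨ cong length (LP.filter-++ (λ p → prime? p) (filter (λ p → p ∣? n) xs) _) ⟩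
    length (filter (λ p → prime? p) (filter (λ p → p ∣? n) xs) ++ filter (λ p → prime? p) (filter (λ p → p ∣? n) ys))
  ≡⟨ LP.length-++ (filter (λ p → prime? p) (filter (λ p → p ∣? n) xs)) ⟩
    #primeDivisors n xs + #primeDivisors n ys
  ∎
  where open ≡-Reasoning

#primeDivisors-yes : ∀ {n q} → PrimeDivisor n q → #primeDivisors n [ q ] ≡ 1
#primeDivisors-yes {n} {q} (q∣n , q-prime) with q ∣? n
... | no q∤n = ⊥-elim (q∤n q∣n)
... | yes _ with prime? q
...   | no ¬prime = ⊥-elim (¬prime q-prime)
...   | yes _     = refl

#primeDivisors-no : ∀ {n q} → ¬ PrimeDivisor n q → #primeDivisors n [ q ] ≡ 0
#primeDivisors-no {n} {q} ¬pd with q ∣? n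
... | no _    = refl
... | yes q∣n with prime? q
...   | no _        = refl
...   | yes q-prime = ⊥-elim (¬pd (q∣n , q-prime))

#primeDivisors-single-cong : ∀ {a b q} → PrimeDivisor a q ⇔ PrimeDivisor b q →
                             #primeDivisors a [ q ] ≡ #primeDivisors b [ q ]
#primeDivisors-single-cong {a} {b} {q} a⇔b = by-cases ((q ∣? a) ×-dec (prime? q))
  where
  by-cases : Dec (PrimeDivisor a q) → #primeDivisors a [ q ] ≡ #primeDivisors b [ q ]
  by-cases (yes a-q) = trans (#primeDivisors-yes a-q) (sym (#primeDivisors-yes (Equivalence.to a⇔b a-q)))
  by-cases (no ¬a-q) = trans (#primeDivisors-no ¬a-q) (sym (#primeDivisors-no (λ b-q → ¬a-q (Equivalence.from a⇔b b-q))))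

#primeDivisors-range1-suc : ∀ n N → #primeDivisors n (range1 (suc N)) ≡ #primeDivisors n (range1 N) + #primeDivisors n [ suc N ]
#primeDivisors-range1-suc n N = #primeDivisors-++ n (range1 N) [ suc N ]

#primeDivisors-cong : ∀ a b N → (∀ q → q ≤ N → PrimeDivisor a q ⇔ PrimeDivisor b q) →
                      #primeDivisors a (range1 N) ≡ #primeDivisors b (range1 N)
#primeDivisors-cong a b zero    a⇔b = refl
#primeDivisors-cong a b (suc N) a⇔b = begin
    #primeDivisors a (range1 (suc N))
  ≡⟨ #primeDivisors-range1-suc a N ⟩
    #primeDivisors a (range1 N) + #primeDivisors a [ suc N ]
  ≡⟨ cong₂ _+_ (#primeDivisors-cong a b N (λ q q≤N → a⇔b q (ℕP.m≤n⇒m≤1+n q≤N)))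
               (#primeDivisors-single-cong (a⇔b (suc N) ℕP.≤-refl)) ⟩
    #primeDivisors b (range1 N) + #primeDivisors b [ suc N ]
  ≡⟨ sym (#primeDivisors-range1-suc b N) ⟩
    #primeDivisors b (range1 (suc N))
  ∎
  where open ≡-Reasoning

#primeDivisors-step : ∀ a b p N → p ≤ N → (∀ q → q ≢ p → PrimeDivisor a q ⇔ PrimeDivisor b q) →
                      PrimeDivisor b p → ¬ PrimeDivisor a p →
                      #primeDivisors b (range1 N) ≡ suc (#primeDivisors a (range1 N))
#primeDivisors-step a b p zero    p≤0 a⇔b (_ , p-prime) ¬a-p = ⊥-elim (ℕP.<⇒≱ (prime>1 p-prime) (ℕP.≤-trans p≤0 z≤n))
#primeDivisors-step a b p (suc N) p≤N a⇔b b-p ¬a-p with suc N ℕ.≟ p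
... | yes refl = begin
    #primeDivisors b (range1 (suc N))
  ≡⟨ #primeDivisors-range1-suc b N ⟩
    #primeDivisors b (range1 N) + #primeDivisors b [ suc N ]
  ≡⟨ cong₂ _+_ (sym (#primeDivisors-cong a b N below-p)) (#primeDivisors-yes b-p) ⟩
    #primeDivisors a (range1 N) + 1
  ≡⟨ ℕP.+-comm (#primeDivisors a (range1 N)) 1 ⟩
    suc (#primeDivisors a (range1 N))
  ≡⟨ cong suc (sym (ℕP.+-identityʳ _)) ⟩
    suc (#primeDivisors a (range1 N) + 0)
  ≡⟨ cong (λ z → suc (#primeDivisors a (range1 N) + z)) (sym (#primeDivisors-no ¬a-p)) ⟩
    suc (#primeDivisors a (range1 N) + #primeDivisors a [ suc N ])
  ≡⟨ cong suc (sym (#primeDivisors-range1-suc a N)) ⟩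
    suc (#primeDivisors a (range1 (suc N)))
  ∎
  where
  open ≡-Reasoning
  below-p : ∀ q → q ≤ N → PrimeDivisor a q ⇔ PrimeDivisor b q
  below-p q q≤N = a⇔b q (λ q≡p → ℕP.<-irrefl q≡p (s≤s q≤N))
... | no N+1≢p = begin
    #primeDivisors b (range1 (suc N))
  ≡⟨ #primeDivisors-range1-suc b N ⟩
    #primeDivisors b (range1 N) + #primeDivisors b [ suc N ]
  ≡⟨ cong₂ _+_ (#primeDivisors-step a b p N p≤N′ a⇔b b-p ¬a-p)
               (sym (#primeDivisors-single-cong (a⇔b (suc N) N+1≢p))) ⟩
    suc (#primeDivisors a (range1 N) + #primeDivisors a [ suc N ])
  ≡⟨ cong suc (sym (#primeDivisors-range1-suc a N)) ⟩
    suc (#primeDivisors a (range1 (suc N)))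
  ∎
  where
  open ≡-Reasoning
  p≤N′ : p ≤ N
  p≤N′ = ℕP.≤-pred (ℕP.≤∧≢⇒< p≤N (λ p≡N+1 → N+1≢p (sym p≡N+1)))

-- all prime divisors of n ≥ 1 lie in 1..n, so counting further changes nothing
#primeDivisors-beyond : ∀ n N → 1 ≤ n → n ≤ N → #primeDivisors n (range1 N) ≡ length (primeDivisors n)
#primeDivisors-beyond (suc n) zero _ ()
#primeDivisors-beyond n (suc N) 1≤n n≤N with n ℕ.≟ suc N
... | yes refl = refl
... | no n≢N+1 = begin
    #primeDivisors n (range1 (suc N))
  ≡⟨ #primeDivisors-range1-suc n N ⟩
    #primeDivisors n (range1 N) + #primeDivisors n [ suc N ]
  ≡⟨ cong₂ _+_ (#primeDivisors-beyond n N 1≤n n≤N′) (#primeDivisors-no too-large) ⟩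
    length (primeDivisors n) + 0
  ≡⟨ ℕP.+-identityʳ _ ⟩
    length (primeDivisors n)
  ∎
  where
  open ≡-Reasoning
  n≤N′ : n ≤ N
  n≤N′ = ℕP.≤-pred (ℕP.≤∧≢⇒< n≤N n≢N+1)
  too-large : ¬ PrimeDivisor n (suc N)
  too-large (N+1∣n , _) = ℕP.<⇒≱ (s≤s n≤N′) (∣⇒≤ {{ℕ.>-nonZero 1≤n}} N+1∣n)

-- the prime divisors of t·p are those of t together with the new prime p
length-primeDivisors-*new-prime : ∀ t p → Prime p → ¬ p ∣ t → 1 ≤ t →
                              length (primeDivisors (t * p)) ≡ suc (length (primeDivisors t))
length-primeDivisors-*new-prime t p p-prime p∤t 1≤t = begin
    #primeDivisors (t * p) (range1 (t * p))
  ≡⟨ #primeDivisors-step t (t * p) p (t * p) p≤tp same-others (n∣m*n t , p-prime) (λ pd → p∤t (proj₁ pd)) ⟩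
    suc (#primeDivisors t (range1 (t * p)))
  ≡⟨ cong suc (#primeDivisors-beyond t (t * p) 1≤t (ℕP.m≤m*n t p)) ⟩
    suc (length (primeDivisors t))
  ∎
  where
  open ≡-Reasoning
  instance
    p≢0 : NonZero p
    p≢0 = prime⇒nonZero p-prime
    t≢0 : NonZero t
    t≢0 = ℕ.>-nonZero 1≤t
  p≤tp : p ≤ t * p
  p≤tp = ℕP.m≤n*m p t
  same-others : ∀ q → q ≢ p → PrimeDivisor t q ⇔ PrimeDivisor (t * p) q
  same-others q q≢p = mk⇔ (λ (q∣t , q-prime) → ∣m⇒∣m*n p q∣t , q-prime)
                          (λ (q∣tp , q-prime) → divides-t q∣tp q-prime , q-prime)
    where
    divides-t : q ∣ t * p → Prime q → q ∣ t
    divides-t q∣tp q-prime with euclidsLemma t p q-prime q∣tp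
    ... | inj₁ q∣t = q∣t
    ... | inj₂ q∣p = ⊥-elim (q≢p (prime∣prime q-prime p-prime q∣p))

range1-∈ : ∀ {q} N → 1 ≤ q → q ≤ N → q ∈ range1 N
range1-∈ {suc q} zero    _   ()
range1-∈ {q}     (suc N) 1≤q q≤N with q ℕ.≟ suc N
... | yes refl = ∈-++⁺ʳ (range1 N) (here refl)
... | no q≢N+1 = ∈-++⁺ˡ (range1-∈ N 1≤q (ℕP.≤-pred (ℕP.≤∧≢⇒< q≤N q≢N+1)))

primeDivisors-∈⁻ : ∀ {q} n → q ∈ primeDivisors n → PrimeDivisor n q
primeDivisors-∈⁻ n q∈ =
  let (q∈divisors , q-prime) = ∈-filter⁻ (λ p → prime? p) {xs = filter (λ p → p ∣? n) (range1 n)} q∈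
      (_ , q∣n) = ∈-filter⁻ (λ p → p ∣? n) {xs = range1 n} q∈divisors
  in q∣n , q-prime

primeDivisors-∈⁺ : ∀ {q} n → 1 ≤ n → PrimeDivisor n q → q ∈ primeDivisors n
primeDivisors-∈⁺ n 1≤n (q∣n , q-prime) = ∈-filter⁺ (λ p → prime? p)
  (∈-filter⁺ (λ p → p ∣? n) (range1-∈ n (ℕP.<⇒≤ (prime>1 q-prime)) (∣⇒≤ {{ℕ.>-nonZero 1≤n}} q∣n)) q∣n) q-prime

noSquareIn : ℕ → List ℕ → Bool
noSquareIn n = foldr (λ p b → not (does ((p * p) ∣? n)) ∧ b) true

noSquareIn-intro : ∀ n xs → (∀ q → q ∈ xs → ¬ q * q ∣ n) → noSquareIn n xs ≡ true
noSquareIn-intro n []       no-square = refl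
noSquareIn-intro n (x ∷ xs) no-square with (x * x) ∣? n
... | yes xx∣n = ⊥-elim (no-square x (here refl) xx∣n)
... | no _     = noSquareIn-intro n xs (λ q q∈xs → no-square q (there q∈xs))

noSquareIn-elim : ∀ n xs → noSquareIn n xs ≡ true → ∀ q → q ∈ xs → ¬ q * q ∣ n
noSquareIn-elim n (x ∷ xs) true≡ q q∈ qq∣n with (x * x) ∣? n
noSquareIn-elim n (x ∷ xs) ()    q q∈          qq∣n | yes _
noSquareIn-elim n (x ∷ xs) true≡ q (here refl) qq∣n | no xx∤n = xx∤n qq∣n
noSquareIn-elim n (x ∷ xs) true≡ q (there q∈)  qq∣n | no _    = noSquareIn-elim n xs true≡ q q∈ qq∣n

squarefree-intro : ∀ n → (∀ q → PrimeDivisor n q → ¬ q * q ∣ n) → squarefree n ≡ true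
squarefree-intro n no-square = noSquareIn-intro n (primeDivisors n) λ q q∈ → no-square q (primeDivisors-∈⁻ n q∈)

squarefree-elim : ∀ n → 1 ≤ n → squarefree n ≡ true → ∀ q → PrimeDivisor n q → ¬ q * q ∣ n
squarefree-elim n 1≤n sf q q-pd = noSquareIn-elim n (primeDivisors n) sf q (primeDivisors-∈⁺ n 1≤n q-pd)

squarefree-*new-prime : ∀ t p → Prime p → ¬ p ∣ t → 1 ≤ t → squarefree (t * p) ≡ squarefree t
squarefree-*new-prime t p p-prime p∤t 1≤t = ⇔→≡ (mk⇔ to from)
  where
  instance
    p≢0 : NonZero p
    p≢0 = prime⇒nonZero p-prime
  1≤tp : 1 ≤ t * p
  1≤tp = ℕP.≤-trans 1≤t (ℕP.m≤m*n t p)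
  to : squarefree (t * p) ≡ true → squarefree t ≡ true
  to sf = squarefree-intro t λ q (q∣t , q-prime) qq∣t →
    squarefree-elim (t * p) 1≤tp sf q (∣m⇒∣m*n p q∣t , q-prime) (∣m⇒∣m*n p qq∣t)
  from : squarefree t ≡ true → squarefree (t * p) ≡ true
  from sf = squarefree-intro (t * p) no-square
    where
    no-square : ∀ q → PrimeDivisor (t * p) q → ¬ q * q ∣ t * p
    no-square q (_ , q-prime) qq∣tp with q ℕ.≟ p
    ... | yes refl = p∤t (*-cancelʳ-∣ q qq∣tp)
    ... | no q≢p   = squarefree-elim t 1≤t sf q (∣-trans (m∣m*n q) qq∣t , q-prime) qq∣t
      where
      p∤qq : ¬ p ∣ q * q
      p∤qq p∣qq with euclidsLemma q q p-prime p∣qq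
      ... | inj₁ p∣q = q≢p (sym (prime∣prime p-prime q-prime p∣q))
      ... | inj₂ p∣q = q≢p (sym (prime∣prime p-prime q-prime p∣q))
      qq∣t : q * q ∣ t
      qq∣t = coprime-divisor (prime∤⇒coprime p-prime p∤qq) (subst (q * q ∣_) (ℕP.*-comm t p) qq∣tp)

squarefree-*old-prime : ∀ t p → Prime p → p ∣ t → 1 ≤ t → squarefree (t * p) ≡ false
squarefree-*old-prime t p p-prime p∣t 1≤t with squarefree (t * p) in sf
... | false = refl
... | true  = ⊥-elim (squarefree-elim (t * p) 1≤tp sf p (n∣m*n t , p-prime) pp∣tp)
  where
  instance
    p≢0 : NonZero p
    p≢0 = prime⇒nonZero p-prime
  1≤tp : 1 ≤ t * p
  1≤tp = ℕP.≤-trans 1≤t (ℕP.m≤m*n t p)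
  pp∣tp : p * p ∣ t * p
  pp∣tp = subst (p * p ∣_) (ℕP.*-comm p t) (*-pres-∣ (∣-refl {p}) p∣t)

μ-*new-prime : ∀ t p → Prime p → ¬ p ∣ t → 1 ≤ t → μ (t * p) ≡ ℤ.- μ t
μ-*new-prime t p p-prime p∤t 1≤t
  rewrite squarefree-*new-prime t p p-prime p∤t 1≤t | length-primeDivisors-*new-prime t p p-prime p∤t 1≤t
  with squarefree t
... | true  = ℤP.-1*i≡-i _
... | false = refl

μ-*old-prime : ∀ t p → Prime p → p ∣ t → 1 ≤ t → μ (t * p) ≡ ℤ.0ℤ
μ-*old-prime t p p-prime p∣t 1≤t rewrite squarefree-*old-prime t p p-prime p∣t 1≤t = refl

ε : ℕ → ℕ → ℚ
ε p n with p ∣? n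
... | yes _ = 0ℚ
... | no _  = 1ℚ

ε-cong : ∀ p a b → (p ∣ a → p ∣ b) → (p ∣ b → p ∣ a) → ε p a ≡ ε p b
ε-cong p a b a⇒b b⇒a with p ∣? a | p ∣? b
... | yes _   | yes _   = refl
... | no _    | no _    = refl
... | yes p∣a | no p∤b  = ⊥-elim (p∤b (a⇒b p∣a))
... | no p∤a  | yes p∣b = ⊥-elim (p∤a (b⇒a p∣b))

neg-/1 : ∀ i → (ℤ.- i) / 1 ≡ ℚ.- (i / 1)
neg-/1 (+ zero)     = refl
neg-/1 ℤ.+[1+ n ]   = refl
neg-/1 ℤ.-[1+ n ]   = sym (involutive (+ suc n / 1))
  where
  involutive : ∀ x → ℚ.- (ℚ.- x) ≡ x
  involutive x = solve (x ∷ []) ℚring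

μ-*prime : ∀ t p → Prime p → 1 ≤ t → μ (t * p) / 1 ≡ ℚ.- (ε p t ℚ.* (μ t / 1))
μ-*prime t p p-prime 1≤t with p ∣? t
... | yes p∣t rewrite μ-*old-prime t p p-prime p∣t 1≤t = sym (cong ℚ.-_ (ℚP.*-zeroˡ (μ t / 1)))
... | no p∤t  rewrite μ-*new-prime t p p-prime p∤t 1≤t =
  trans (neg-/1 (μ t)) (cong ℚ.-_ (sym (ℚP.*-identityˡ (μ t / 1))))

1/-* : ∀ a b .{{_ : NonZero a}} .{{_ : NonZero b}} .{{_ : NonZero (a * b)}} →
       + 1 / (a * b) ≡ (+ 1 / a) ℚ.* (+ 1 / b)
1/-* a b = sym (trans (*-as-/ (+ 1 / a) (+ 1 / b))
                      (ℚP./-cong {↥ x ℤ.* ↥ y} {↧ₙ x * ↧ₙ y} {+ 1 ℤ.* + 1} {a * b}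
                                 (cong₂ ℤ._*_ (numerator a) (numerator b)) (cong₂ _*_ (denominator a) (denominator b))))
  where
  x : ℚ
  x = + 1 / a
  y : ℚ
  y = + 1 / b
  *-as-/ : ∀ x y → x ℚ.* y ≡ (↥ x ℤ.* ↥ y) / (↧ₙ x * ↧ₙ y)
  *-as-/ (ℚ.mkℚ _ _ _) (ℚ.mkℚ _ _ _) = refl
  numerator : ∀ a .{{_ : NonZero a}} → ↥ (+ 1 / a) ≡ + 1
  numerator a = trans (sym (ℤP.*-identityʳ (↥ (+ 1 / a)))) (trans (cong (λ g → ↥ (+ 1 / a) ℤ.* + g) (sym (GCD.gcd-zeroˡ a))) (ℚP.↥-/ (+ 1) a))
  denominator : ∀ a .{{_ : NonZero a}} → ↧ₙ (+ 1 / a) ≡ a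
  denominator a = cong ℤ.∣_∣ (trans (sym (ℤP.*-identityʳ (↧ (+ 1 / a)))) (trans (cong (λ g → ↧ (+ 1 / a) ℤ.* + g) (sym (GCD.gcd-zeroˡ a))) (ℚP.↧-/ (+ 1) a)))

coeff-M-*-multiple : ∀ n p q → coeff (M (suc n * suc p)) (q * suc p) ≡ (+ 1 / suc p) ℚ.* coeff (M (suc n)) q
coeff-M-*-multiple n p q with q ∣? suc n
... | yes (divides t n+1≡tq) = begin
    coeff (M (suc n * suc p)) (q * suc p)
  ≡⟨ coeff-M-divisor (p + n * suc p) (q * suc p) t (trans (cong (_* suc p) n+1≡tq) (rearrange t q (suc p))) ⟩
    (+ 1 / (suc n * suc p)) ℚ.* (μ t / 1)
  ≡⟨ cong (ℚ._* (μ t / 1)) (1/-* (suc n) (suc p)) ⟩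
    ((+ 1 / suc n) ℚ.* (+ 1 / suc p)) ℚ.* (μ t / 1)
  ≡⟨ swap (+ 1 / suc n) (+ 1 / suc p) (μ t / 1) ⟩
    (+ 1 / suc p) ℚ.* ((+ 1 / suc n) ℚ.* (μ t / 1))
  ≡⟨ cong ((+ 1 / suc p) ℚ.*_) (sym (coeff-M-divisor n q t (trans n+1≡tq (ℕP.*-comm t q)))) ⟩
    (+ 1 / suc p) ℚ.* coeff (M (suc n)) q
  ∎
  where
  open ≡-Reasoning
  rearrange : ∀ t q p → t * q * p ≡ q * p * t
  rearrange = solve-∀
  swap : ∀ a b x → (a ℚ.* b) ℚ.* x ≡ b ℚ.* (a ℚ.* x)
  swap a b x = solve (a ∷ b ∷ x ∷ []) ℚring
... | no q∤n = begin
    coeff (M (suc n * suc p)) (q * suc p)   ≡⟨ coeff-M-nondivisor (p + n * suc p) (q * suc p) (λ qp∣np → q∤n (*-cancelʳ-∣ (suc p) qp∣np)) ⟩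
    0ℚ                                      ≡⟨ sym (ℚP.*-zeroʳ (+ 1 / suc p)) ⟩
    (+ 1 / suc p) ℚ.* 0ℚ                    ≡⟨ cong ((+ 1 / suc p) ℚ.*_) (sym (coeff-M-nondivisor n q q∤n)) ⟩
    (+ 1 / suc p) ℚ.* coeff (M (suc n)) q   ∎
  where open ≡-Reasoning

ε-*coprime : ∀ p t k → Prime p → ¬ p ∣ k → ε p (t * k) ≡ ε p t
ε-*coprime p t k p-prime p∤k = ε-cong p (t * k) t p∣tk⇒p∣t (∣m⇒∣m*n k)
  where
  p∣tk⇒p∣t : p ∣ t * k → p ∣ t
  p∣tk⇒p∣t p∣tk with euclidsLemma t k p-prime p∣tk
  ... | inj₁ p∣t = p∣t
  ... | inj₂ p∣k = ⊥-elim (p∤k p∣k)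

coeff-M-*prime-nonmultiple : ∀ n p k → Prime (suc p) → ¬ suc p ∣ k →
  coeff (M (suc n * suc p)) k ≡ (+ 1 / suc p) ℚ.* (ℚ.- (ε (suc p) (suc n) ℚ.* coeff (M (suc n)) k))
coeff-M-*prime-nonmultiple n p k p-prime p∤k with k ∣? suc n
... | yes (divides zero ())
... | yes (divides (suc t) n+1≡tk) = begin
    coeff (M (suc n * suc p)) k
  ≡⟨ coeff-M-divisor (p + n * suc p) k (suc t * suc p) (trans (cong (_* suc p) n+1≡tk) (rearrange (suc t) k (suc p))) ⟩
    (+ 1 / (suc n * suc p)) ℚ.* (μ (suc t * suc p) / 1)
  ≡⟨ cong₂ ℚ._*_ (1/-* (suc n) (suc p)) (μ-*prime (suc t) (suc p) p-prime (s≤s z≤n)) ⟩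
    ((+ 1 / suc n) ℚ.* (+ 1 / suc p)) ℚ.* (ℚ.- (ε (suc p) (suc t) ℚ.* (μ (suc t) / 1)))
  ≡⟨ cong (λ e → ((+ 1 / suc n) ℚ.* (+ 1 / suc p)) ℚ.* (ℚ.- (e ℚ.* (μ (suc t) / 1)))) ε-t≡ε-n ⟩
    ((+ 1 / suc n) ℚ.* (+ 1 / suc p)) ℚ.* (ℚ.- (ε (suc p) (suc n) ℚ.* (μ (suc t) / 1)))
  ≡⟨ regroup (+ 1 / suc n) (+ 1 / suc p) (ε (suc p) (suc n)) (μ (suc t) / 1) ⟩
    (+ 1 / suc p) ℚ.* (ℚ.- (ε (suc p) (suc n) ℚ.* ((+ 1 / suc n) ℚ.* (μ (suc t) / 1))))
  ≡⟨ cong (λ c → (+ 1 / suc p) ℚ.* (ℚ.- (ε (suc p) (suc n) ℚ.* c)))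
          (sym (coeff-M-divisor n k (suc t) (trans n+1≡tk (ℕP.*-comm (suc t) k)))) ⟩
    (+ 1 / suc p) ℚ.* (ℚ.- (ε (suc p) (suc n) ℚ.* coeff (M (suc n)) k))
  ∎
  where
  open ≡-Reasoning
  ε-t≡ε-n : ε (suc p) (suc t) ≡ ε (suc p) (suc n)
  ε-t≡ε-n = sym (trans (cong (ε (suc p)) n+1≡tk) (ε-*coprime (suc p) (suc t) k p-prime p∤k))
  rearrange : ∀ t k p → t * k * p ≡ k * (t * p)
  rearrange = solve-∀
  regroup : ∀ a b e x → (a ℚ.* b) ℚ.* (ℚ.- (e ℚ.* x)) ≡ b ℚ.* (ℚ.- (e ℚ.* (a ℚ.* x)))
  regroup a b e x = solve (a ∷ b ∷ e ∷ x ∷ []) ℚring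
... | no k∤n = begin
    coeff (M (suc n * suc p)) k
  ≡⟨ coeff-M-nondivisor (p + n * suc p) k k∤np ⟩
    0ℚ
  ≡⟨ vanish (+ 1 / suc p) (ε (suc p) (suc n)) ⟩
    (+ 1 / suc p) ℚ.* (ℚ.- (ε (suc p) (suc n) ℚ.* 0ℚ))
  ≡⟨ cong (λ c → (+ 1 / suc p) ℚ.* (ℚ.- (ε (suc p) (suc n) ℚ.* c))) (sym (coeff-M-nondivisor n k k∤n)) ⟩
    (+ 1 / suc p) ℚ.* (ℚ.- (ε (suc p) (suc n) ℚ.* coeff (M (suc n)) k))
  ∎
  where
  open ≡-Reasoning
  k∤np : ¬ k ∣ suc n * suc p
  k∤np k∣np = k∤n (coprime-divisor (prime∤⇒coprime p-prime p∤k) (subst (k ∣_) (ℕP.*-comm (suc n) (suc p)) k∣np))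
  vanish : ∀ a e → 0ℚ ≡ a ℚ.* (ℚ.- (e ℚ.* 0ℚ))
  vanish a e = solve (a ∷ e ∷ []) ℚring

-- ε_p(n) [x^{qp}] M_n = 0: either p ∣ n, or qp ∤ n
ε-coeff-M-multiple : ∀ n p q → ε p (suc n) ℚ.* coeff (M (suc n)) (q * p) ≡ 0ℚ
ε-coeff-M-multiple n p q with p ∣? suc n
... | yes _  = ℚP.*-zeroˡ (coeff (M (suc n)) (q * p))
... | no p∤n = trans (cong (1ℚ ℚ.*_) (coeff-M-nondivisor n (q * p) λ qp∣n → p∤n (∣-trans (n∣m*n q) qp∣n)))
                     (ℚP.*-zeroʳ 1ℚ)

-- The necklace recurrence: for a prime p, M_{np}(x) = (1/p) (M_n(x^p) - ε_p(n) M_n(x)),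
-- stated for n + 1 and p + 1 so that M and 1/p compute.
necklace-recurrence : ∀ n p → Prime (suc p) → ∀ k →
  coeff (M (suc n * suc p)) k
  ≡ (+ 1 / suc p) ℚ.* (substPow (suc p) (coeff (M (suc n))) k - ε (suc p) (suc n) ℚ.* coeff (M (suc n)) k)
necklace-recurrence n p p-prime k = by-cases (suc p ∣? k)
  where
  open ≡-Reasoning
  f : ℕ → ℚ
  f = coeff (M (suc n))
  by-cases : Dec (suc p ∣ k) →
    coeff (M (suc n * suc p)) k ≡ (+ 1 / suc p) ℚ.* (substPow (suc p) f k - ε (suc p) (suc n) ℚ.* f k)
  by-cases (yes (divides q refl)) = begin
      coeff (M (suc n * suc p)) (q * suc p)
    ≡⟨ coeff-M-*-multiple n p q ⟩
      (+ 1 / suc p) ℚ.* f q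
    ≡⟨ cong ((+ 1 / suc p) ℚ.*_) (sym (ℚP.+-identityʳ (f q))) ⟩
      (+ 1 / suc p) ℚ.* (f q - 0ℚ)
    ≡⟨ cong₂ (λ x y → (+ 1 / suc p) ℚ.* (x - y)) (sym (substPow-multiple (suc p) f q (s≤s z≤n)))
                                                (sym (ε-coeff-M-multiple n (suc p) q)) ⟩
      (+ 1 / suc p) ℚ.* (substPow (suc p) f (q * suc p) - ε (suc p) (suc n) ℚ.* f (q * suc p))
    ∎
  by-cases (no p∤k) = begin
      coeff (M (suc n * suc p)) k
    ≡⟨ coeff-M-*prime-nonmultiple n p k p-prime p∤k ⟩
      (+ 1 / suc p) ℚ.* (ℚ.- (ε (suc p) (suc n) ℚ.* f k))
    ≡⟨ cong ((+ 1 / suc p) ℚ.*_) (sym (ℚP.+-identityˡ _)) ⟩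
      (+ 1 / suc p) ℚ.* (0ℚ - ε (suc p) (suc n) ℚ.* f k)
    ≡⟨ cong (λ x → (+ 1 / suc p) ℚ.* (x - ε (suc p) (suc n) ℚ.* f k)) (sym (substPow-nonmultiple (suc p) f k p∤k)) ⟩
      (+ 1 / suc p) ℚ.* (substPow (suc p) f k - ε (suc p) (suc n) ℚ.* f k)
    ∎

-- Primes p for which x^m + c ∣ x^{mp} + c, i.e. (-c)^p = -c
Admissible : ℚ → ℕ → Set
Admissible c p = Prime p × pow (ℚ.- c) p ≡ ℚ.- c

-- If x^m + c divides M_n, it divides M_{np} for every admissible prime p:
-- M_{np} is a linear combination of M_n(x^p) and M_n(x).
lift-prime : ∀ m c n p → Admissible c p → 1 ≤ n → (X^ m +ᴾ const c) ∣ᴾ M n → (X^ m +ᴾ const c) ∣ᴾ M (n * p)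
lift-prime m c n       zero    (0-prime , _) _ _ = ⊥-elim (ℕP.<⇒≱ (prime>1 0-prime) z≤n)
lift-prime m c (suc n) (suc p) (p-prime , pow≡) _ ∣Mn =
  MultipleOf⇒∣ᴾ m c (M (suc n * suc p)) (MultipleOf-cong {m} {c} recurrence combination)
  where
  f : ℕ → ℚ
  f = coeff (M (suc n))
  Mn : MultipleOf m c f
  Mn = ∣ᴾ⇒MultipleOf m c (M (suc n)) ∣Mn
  a : ℚ
  a = + 1 / suc p
  b : ℚ
  b = ℚ.- (a ℚ.* ε (suc p) (suc n))
  combination : MultipleOf m c (λ k → a ℚ.* substPow (suc p) f k ℚ.+ b ℚ.* f k)
  combination = MultipleOf-linear {m} {c} a b (MultipleOf-substPow {m} {c} (suc p) (s≤s z≤n) pow≡ Mn) Mn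
  as-combination : ∀ a e x y → a ℚ.* (x - e ℚ.* y) ≡ a ℚ.* x ℚ.+ (ℚ.- (a ℚ.* e)) ℚ.* y
  as-combination a e x y = solve (a ∷ e ∷ x ∷ y ∷ []) ℚring
  recurrence : ∀ k → a ℚ.* substPow (suc p) f k ℚ.+ b ℚ.* f k ≡ coeff (M (suc n * suc p)) k
  recurrence k = sym (trans (necklace-recurrence n p p-prime k) (as-combination a (ε (suc p) (suc n)) (substPow (suc p) f k) (f k)))

lift-primes : ∀ m c ps → All (Admissible c) ps → ∀ n → 1 ≤ n →
              (X^ m +ᴾ const c) ∣ᴾ M n → (X^ m +ᴾ const c) ∣ᴾ M (n * product ps)
lift-primes m c []       All.[]                n _   ∣Mn = subst (λ d → (X^ m +ᴾ const c) ∣ᴾ M d) (sym (ℕP.*-identityʳ n)) ∣Mn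
lift-primes m c (p ∷ ps) (p-adm All.∷ ps-adm) n 1≤n ∣Mn =
  subst (λ d → (X^ m +ᴾ const c) ∣ᴾ M d) (ℕP.*-assoc n p (product ps))
    (lift-primes m c ps ps-adm (n * p) 1≤np (lift-prime m c n p p-adm 1≤n ∣Mn))
  where
  1≤np : 1 ≤ n * p
  1≤np = ℕP.*-mono-≤ 1≤n (ℕP.<⇒≤ (prime>1 (proj₁ p-adm)))

lift : ∀ m c e → 1 ≤ e → (∀ p → Prime p → p ∣ e → pow (ℚ.- c) p ≡ ℚ.- c) →
       ∀ n → 1 ≤ n → (X^ m +ᴾ const c) ∣ᴾ M n → (X^ m +ᴾ const c) ∣ᴾ M (n * e)
lift m c e 1≤e adm n 1≤n ∣Mn =
  subst (λ e′ → (X^ m +ᴾ const c) ∣ᴾ M (n * e′)) (sym e≡∏)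
    (lift-primes m c (factors fe) (All.tabulate admissible) n 1≤n ∣Mn)
  where
  instance
    e≢0 : NonZero e
    e≢0 = ℕ.>-nonZero 1≤e
  fe : PrimeFactorisation e
  fe = factorise e
  e≡∏ : e ≡ product (factors fe)
  e≡∏ = PrimeFactorisation.isFactorisation fe
  admissible : ∀ {p} → p ∈ factors fe → Admissible c p
  admissible {p} p∈ = p-prime , adm p p-prime (subst (p ∣_) (sym e≡∏) (∈⇒∣product p∈))
    where
    p-prime : Prime p
    p-prime = All.lookup (PrimeFactorisation.factorsPrime fe) p∈

pow-1 : ∀ n → pow 1ℚ n ≡ 1ℚ
pow-1 zero    = refl
pow-1 (suc n) rewrite pow-1 n = refl

pow-neg1-odd : ∀ n → ¬ 2 ∣ n → pow (ℚ.- 1ℚ) n ≡ ℚ.- 1ℚ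
pow-neg1-odd zero             odd = ⊥-elim (odd (divides 0 refl))
pow-neg1-odd (suc zero)       odd = refl
pow-neg1-odd (suc (suc n))    odd rewrite pow-neg1-odd n (λ { (divides q n≡2q) → odd (divides (suc q) (cong (λ x → suc (suc x)) n≡2q)) }) = refl

theorem2p7 : (m d : ℕ) → 1 ≤ m → 1 ≤ d →
    ((X^-1 m ∣ᴾ M d) → (e : ℕ) → 1 ≤ e → X^-1 m ∣ᴾ M (d * e))
    × ((X^+1 m ∣ᴾ M d) → (e : ℕ) → 1 ≤ e → ¬ (2 ∣ e) → X^+1 m ∣ᴾ M (d * e))
theorem2p7 m d _ 1≤d = minus-case , plus-case
  where
  minus-case : (X^-1 m ∣ᴾ M d) → (e : ℕ) → 1 ≤ e → X^-1 m ∣ᴾ M (d * e)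
  minus-case ∣Md e 1≤e = lift m (ℚ.- 1ℚ) e 1≤e (λ p _ _ → pow-1 p) d 1≤d ∣Md
  -- c = 1: the prime factors of an odd e are odd, and (-1)^p = -1 for odd p
  plus-case : (X^+1 m ∣ᴾ M d) → (e : ℕ) → 1 ≤ e → ¬ (2 ∣ e) → X^+1 m ∣ᴾ M (d * e)
  plus-case ∣Md e 1≤e e-odd =
    lift m 1ℚ e 1≤e (λ p _ p∣e → pow-neg1-odd p (λ 2∣p → e-odd (∣-trans 2∣p p∣e))) d 1≤d ∣Md
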